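{- Let $T$ be a tree with diameter $m$ for some integer $m\ge3$. Then $[m-2]\subseteq\Upsilon(T)$.
   Context: All graphs are finite and simple. For a positive integer $p$ and a digraph $D=(V,A)$ with $A\subseteq V\times V$ (loops allowed), the $p$-competition graph $C_p(D)$ has vertex set $V$, and distinct $x,y$ are adjacent iff there are $p$ distinct vertices $a_1,\dots,a_p\in V$ with $(x,a_i),(y,a_i)\in A$ for all $i$. A graph is a $p$-competition graph if it equals $C_p(D)$ for some digraph $D$. For a graph $G$ with $n$ vertices, $\Upsilon(G)=\{p\in\{1,\dots,n\}\mid G\text{ is a }p\text{ -competition graph}\}$; $[k]=\{1,\dots,k\}$. -}

module Defs where

open import Data.Nat using (ℕ; zero; suc; _≤_; _∸_)
open import Data.Fin using (Fin; zero; suc; inject₁; fromℕ)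
open import Data.Product using (Σ; ∃; ∃-syntax; _×_; _,_)
open import Relation.Binary.PropositionalEquality using (_≡_; _≢_)
open import Relation.Nullary using (¬_)
open import Function.Definitions using (Injective)
open import Function.Bundles using (_⇔_)

record Graph (n : ℕ) : Set₁ where
  field
    Adj    : Fin n → Fin n → Set
    sym    : ∀ {x y} → Adj x y → Adj y x
    irrefl : ∀ {x} → ¬ Adj x x
open Graph public

record Digraph (n : ℕ) : Set₁ where
  field
    Arc : Fin n → Fin n → Set
open Digraph public

Walk : ∀ {n} → Graph n → Fin n → Fin n → ℕ → Set
Walk {n} G x y k =
  Σ (Fin (suc k) → Fin n) λ w →
    (w zero ≡ x) × (w (fromℕ k) ≡ y) × (∀ (i : Fin k) → Adj G (w (inject₁ i)) (w (suc i)))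

Connected : ∀ {n} → Graph n → Set
Connected {n} G = ∀ (x y : Fin n) → ∃[ k ] Walk G x y k

-- A cycle of length j+3: distinct vertices c 0, ..., c (j+2), consecutive ones adjacent,
-- and the last adjacent to the first.
HasCycle : ∀ {n} → Graph n → Set
HasCycle {n} G =
  ∃[ j ] Σ (Fin (suc (suc (suc j))) → Fin n) λ c →
    Injective _≡_ _≡_ c
    × (∀ (i : Fin (suc (suc j))) → Adj G (c (inject₁ i)) (c (suc i)))
    × Adj G (c (fromℕ (suc (suc j)))) (c zero)

IsTree : ∀ {n} → Graph n → Set
IsTree G = Connected G × ¬ HasCycle G

Dist : ∀ {n} → Graph n → Fin n → Fin n → ℕ → Set
Dist G x y d = Walk G x y d × (∀ k → Walk G x y k → d ≤ k)

Diameter : ∀ {n} → Graph n → ℕ → Set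
Diameter {n} G m =
  (∀ (x y : Fin n) → ∃[ k ] (k ≤ m × Walk G x y k))
  × (∃[ x ] ∃[ y ] Dist G x y m)

IsCompetitionOf : ∀ {n} → ℕ → Digraph n → Graph n → Set
IsCompetitionOf {n} p D G =
  ∀ (x y : Fin n) → x ≢ y →
    Adj G x y ⇔ (Σ (Fin p → Fin n) λ a → (Injective _≡_ _≡_ a × (∀ (i : Fin p) → Arc D x (a i) × Arc D y (a i))))

IsPCompetitionGraph : ∀ {n} → ℕ → Graph n → Set₁
IsPCompetitionGraph {n} p G = ∃[ D ] IsCompetitionOf {n} p D G

InΥ : ∀ {n} → Graph n → ℕ → Set₁
InΥ {n} G p = (1 ≤ p) × (p ≤ n) × IsPCompetitionGraph p G

-- Root T at one end y₀ of a longest path, let g send every vertex to its parent and the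
-- root to the other end x₀.  The only cycle of g then runs through y₀ and x₀ and has length
-- depth x₀ + 1 ≥ m + 1 ≥ p + 3, so g^s z = g^t z forces s = t or |s − t| ≥ p + 3.
-- Let x prey on x, g x, …, g^(p−1) x and on its children.  The ends of an edge x — g x share
-- the p prey x, …, g^(p−1) x.  For non-adjacent x ≠ y all common prey lie among p − 1
-- explicit candidates: if neither is g^(j+1) of the other for some j < p, only
-- g x, …, g^(p−1) x can qualify; if x = g^(j+1) y, the cycle length rules out two
-- exponents of x and leaves room for a single child of x.

module Submission where

open import Defs
open import Data.Nat using (ℕ; zero; suc; _+_; _∸_; _≤_; _<_; z≤n; s≤s; anyUpTo?)
open import Data.Nat.Properties
  using ( +-comm; +-suc; +-identityʳ; +-cancelˡ-≡; +-cancelʳ-≡; +-monoʳ-≤; suc-injective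
        ; ≤-refl; ≤-reflexive; ≤-trans; ≤-<-trans; <-trans; <-cmp; _≤?_; _<?_; ≤-pred
        ; <-irrefl; n≮n; <⇒≤; <⇒≢; <⇒≱; ≰⇒>; ≮⇒≥; n≤1+n; n<1+n; m≤n⇒m≤1+n; m<n⇒m<1+n
        ; m≤m+n; m≤n+m; m≤n⇒m≤o+n; m+n≤o⇒n≤o; m∸n≤m; m∸n+n≡m; m+[n∸m]≡n; m<n⇒0<n∸m
        ; module ≤-Reasoning )
open import Data.Fin as Fin using (Fin; zero; suc; inject₁; fromℕ; toℕ; fromℕ<)
open import Data.Fin.Properties using (injective⇒≤; toℕ<n; toℕ-injective; fromℕ<-injective)
open import Data.List using (List; []; _∷_; _++_; [_]; length; lookup; head)
open import Data.List.Properties using (++-assoc)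
open import Data.List.Membership.Propositional using (_∈_; _∉_)
open import Data.List.Membership.Propositional.Properties
  using (∈-∃++; ∈-++⁻; ∈-++⁺ˡ; ∈-++⁺ʳ; ∈-lookup)
open import Data.List.Relation.Unary.Any using (here; there)
open import Data.Maybe using (just; fromMaybe)
open import Data.Product using (Σ; ∃-syntax; _×_; _,_; proj₁; proj₂)
open import Data.Sum using (_⊎_; inj₁; inj₂)
open import Data.Empty using (⊥; ⊥-elim)
open import Data.Unit using (⊤; tt)
open import Relation.Nullary using (¬_; Dec; yes; no)
open import Relation.Binary.PropositionalEquality as ≡
  using (_≡_; _≢_; refl; trans; cong; cong-app; subst; ≢-sym)
open import Relation.Binary.Definitions using (tri<; tri≈; tri>)
open import Function.Definitions using (Injective)
open import Function.Bundles using (mk⇔)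

module ListWalks {n : ℕ} (G : Graph n) where
  open import Data.List.Membership.DecPropositional (Fin._≟_ {n}) using (_∈?_)

  Chain : Fin n → List (Fin n) → Set
  Chain x []       = ⊤
  Chain x (y ∷ ys) = Adj G x y × Chain y ys

  end : Fin n → List (Fin n) → Fin n
  end x []       = x
  end x (y ∷ ys) = end y ys

  Distinct : List (Fin n) → Set
  Distinct []       = ⊤
  Distinct (x ∷ xs) = x ∉ xs × Distinct xs

  chain-++⁻ : ∀ x xs {ys} → Chain x (xs ++ ys) → Chain x xs × Chain (end x xs) ys
  chain-++⁻ x []       c       = tt , c
  chain-++⁻ x (y ∷ xs) (a , c) = (a , proj₁ (chain-++⁻ y xs c)) , proj₂ (chain-++⁻ y xs c)

  chain-++⁺ : ∀ x xs {ys} → Chain x xs → Chain (end x xs) ys → Chain x (xs ++ ys)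
  chain-++⁺ x []       _        c  = c
  chain-++⁺ x (y ∷ xs) (a , c₁) c₂ = a , chain-++⁺ y xs c₁ c₂

  end-++ : ∀ x xs ys → end x (xs ++ ys) ≡ end (end x xs) ys
  end-++ x []       ys = refl
  end-++ x (y ∷ xs) ys = end-++ y xs ys

  end∈ : ∀ x xs → end x xs ∈ x ∷ xs
  end∈ x []       = here refl
  end∈ x (y ∷ xs) = there (end∈ y xs)

  distinct-++⁻ : ∀ xs {ys} → Distinct (xs ++ ys) →
                 Distinct xs × Distinct ys × (∀ {a} → a ∈ xs → a ∉ ys)
  distinct-++⁻ []       d        = tt , d , λ ()
  distinct-++⁻ (x ∷ xs) (x∉ , d) with distinct-++⁻ xs d
  ... | d₁ , d₂ , disj =
    ((λ x∈ → x∉ (∈-++⁺ˡ x∈)) , d₁) , d₂ ,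
    λ { (here refl) x∈ → x∉ (∈-++⁺ʳ xs x∈) ; (there a∈) → disj a∈ }

  distinct-++⁺ : ∀ xs {ys} → Distinct xs → Distinct ys → (∀ {a} → a ∈ xs → a ∉ ys) →
                 Distinct (xs ++ ys)
  distinct-++⁺ []       _         d₂ _    = d₂
  distinct-++⁺ (x ∷ xs) {ys} (x∉ , d₁) d₂ disj =
    x∉xs++ys , distinct-++⁺ xs d₁ d₂ (λ a∈ → disj (there a∈))
    where
    x∉xs++ys : x ∉ xs ++ ys
    x∉xs++ys x∈ with ∈-++⁻ xs x∈
    ... | inj₁ x∈xs = x∉ x∈xs
    ... | inj₂ x∈ys = disj (here refl) x∈ys

  1≤length : ∀ (xs : List (Fin n)) v ys → 1 ≤ length (xs ++ v ∷ ys)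
  1≤length []       v ys = s≤s z≤n
  1≤length (x ∷ xs) v ys = s≤s z≤n

  2≤length : ∀ (xs : List (Fin n)) a b ys → 2 ≤ length (xs ++ a ∷ b ∷ ys)
  2≤length []       a b ys = s≤s (s≤s z≤n)
  2≤length (x ∷ xs) a b ys = m≤n⇒m≤1+n (2≤length xs a b ys)

  lookup-injective : ∀ xs → Distinct xs → ∀ i j → lookup xs i ≡ lookup xs j → i ≡ j
  lookup-injective (x ∷ xs) d        zero    zero    e = refl
  lookup-injective (x ∷ xs) (x∉ , d) zero    (suc j) e =
    ⊥-elim (x∉ (subst (_∈ xs) (≡.sym e) (∈-lookup j)))
  lookup-injective (x ∷ xs) (x∉ , d) (suc i) zero    e =
    ⊥-elim (x∉ (subst (_∈ xs) e (∈-lookup i)))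
  lookup-injective (x ∷ xs) (x∉ , d) (suc i) (suc j) e = cong suc (lookup-injective xs d i j e)

  lookup-chain : ∀ x ys → Chain x ys →
                 ∀ (i : Fin (length ys)) → Adj G (lookup (x ∷ ys) (inject₁ i)) (lookup ys i)
  lookup-chain x (y ∷ ys) (a , c) zero    = a
  lookup-chain x (y ∷ ys) (a , c) (suc i) = lookup-chain y ys c i

  lookup-end : ∀ x ys → lookup (x ∷ ys) (fromℕ (length ys)) ≡ end x ys
  lookup-end x []       = refl
  lookup-end x (y ∷ ys) = lookup-end y ys

  chain⇒walk : ∀ x ys → Chain x ys → Walk G x (end x ys) (length ys)
  chain⇒walk x ys c = lookup (x ∷ ys) , refl , lookup-end x ys , lookup-chain x ys c

  walk⇒chain : ∀ {x y k} → Walk G x y k → Σ (List (Fin n)) λ ys → Chain x ys × end x ys ≡ y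
  walk⇒chain {k = zero}  (w , refl , refl , _)     = [] , tt , refl
  walk⇒chain {k = suc k} (w , refl , wk , adj)
    with walk⇒chain {k = k} ((λ i → w (suc i)) , refl , wk , λ i → adj (suc i))
  ... | ys , c , e = w (suc zero) ∷ ys , (adj zero , c) , e

  record Path (x y : Fin n) : Set where
    constructor path
    field
      vertices : List (Fin n)
      chain    : Chain x vertices
      ends     : end x vertices ≡ y
      distinct : Distinct (x ∷ vertices)
  open Path public

  shortcut : ∀ x xs → Chain x xs → Path x (end x xs)
  shortcut x []       _       = path [] tt refl ((λ ()) , tt)
  shortcut x (y ∷ xs) (a , c) with shortcut y xs c
  ... | path ys cy ey dy with x ∈? y ∷ ys
  ... | no x∉ = path (y ∷ ys) (a , cy) ey (x∉ , dy)
  ... | yes x∈ with ∈-∃++ x∈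
  ... | pre , post , eq =
    path post (proj₂ (proj₂ (chain-++⁻ x pre (subst (Chain x) eq (a , cy)))))
         (trans (≡.sym (end-++ x pre (x ∷ post))) (trans (cong (end x) (≡.sym eq)) ey))
         (proj₁ (proj₂ (distinct-++⁻ pre (subst Distinct eq dy))))

  walk⇒path : ∀ {x y k} → Walk G x y k → Path x y
  walk⇒path {x} w with walk⇒chain w
  ... | ys , c , refl = shortcut x ys c

module AcyclicPaths {n : ℕ} (G : Graph n) (acyclic : ¬ HasCycle G) where
  open import Data.List.Membership.DecPropositional (Fin._≟_ {n}) using (_∈?_)
  open ListWalks G

  no-closed-chain : ∀ x ys → Distinct (x ∷ ys) → 2 ≤ length ys → Chain x ys → ¬ Adj G (end x ys) x
  no-closed-chain x (a ∷ [])     d (s≤s ()) c closing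
  no-closed-chain x (a ∷ b ∷ zs) d _        c closing =
    acyclic (length zs , lookup (x ∷ a ∷ b ∷ zs) , lookup-injective (x ∷ a ∷ b ∷ zs) d _ _ ,
             lookup-chain x (a ∷ b ∷ zs) c ,
             subst (λ z → Adj G z x) (≡.sym (lookup-end x (a ∷ b ∷ zs))) closing)

  neighbour-on-path⇒next : ∀ {u v r} (P : Path u r) → Adj G u v → v ∈ u ∷ vertices P →
                           head (vertices P) ≡ just v
  neighbour-on-path⇒next P a (here refl) = ⊥-elim (irrefl G a)
  neighbour-on-path⇒next {u} {v} (path vs c _ (u∉ , d)) a (there v∈) with ∈-∃++ v∈
  ... | []      , post , refl = refl
  ... | b ∷ pre , post , refl = ⊥-elim (
    no-closed-chain u ys distinct-ys (s≤s (1≤length pre v [])) chain-ys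
      (subst (λ z → Adj G z u) (≡.sym (end-++ u (b ∷ pre) [ v ])) (sym G a)))
    where
    ys = b ∷ pre ++ [ v ]
    distinct-u∷ys++post : Distinct (u ∷ ys ++ post)
    distinct-u∷ys++post = subst (λ l → Distinct (u ∷ b ∷ l)) (≡.sym (++-assoc pre [ v ] post)) (u∉ , d)
    distinct-ys : Distinct (u ∷ ys)
    distinct-ys = (λ u∈ → proj₁ distinct-u∷ys++post (∈-++⁺ˡ u∈)) ,
                  proj₁ (distinct-++⁻ ys (proj₂ distinct-u∷ys++post))
    chain-ys : Chain u ys
    chain-ys with chain-++⁻ u (b ∷ pre) c
    ... | c₁ , a₂ , _ = chain-++⁺ u (b ∷ pre) c₁ (a₂ , tt)

  no-detour : ∀ {u q r} (P : Path u r) (acc : List (Fin n)) → q ∈ vertices P →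
              Chain q (acc ++ [ u ]) → 1 ≤ length acc → Distinct acc → q ∉ acc →
              (∀ {a} → a ∈ acc → a ∉ u ∷ vertices P) → ⊥
  no-detour {u} {q} (path vs c _ (u∉ , d)) (b ∷ bs) q∈ c-acc _ d-acc q∉acc disj with ∈-∃++ q∈
  ... | pre , post , refl =
    no-closed-chain u ys (u∉ys , distinct-ys) (2≤length pre q b bs) chain-ys
      (subst (λ z → Adj G z u) (≡.sym (end-++ u pre (q ∷ acc))) closing)
    where
    acc = b ∷ bs
    ys = pre ++ q ∷ acc
    d-path = distinct-++⁻ pre d
    closing : Adj G (end q acc) u
    closing = proj₁ (proj₂ (chain-++⁻ q acc c-acc))
    u∉ys : u ∉ ys
    u∉ys u∈ with ∈-++⁻ pre u∈
    ... | inj₁ u∈pre         = u∉ (∈-++⁺ˡ u∈pre)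
    ... | inj₂ (here refl)   = u∉ (∈-++⁺ʳ pre (here refl))
    ... | inj₂ (there u∈acc) = disj u∈acc (here refl)
    distinct-ys : Distinct ys
    distinct-ys = distinct-++⁺ pre (proj₁ d-path) (q∉acc , d-acc) pre-disjoint
      where
      pre-disjoint : ∀ {a} → a ∈ pre → a ∉ q ∷ acc
      pre-disjoint a∈ (here refl)   = proj₂ (proj₂ d-path) a∈ (here refl)
      pre-disjoint a∈ (there a∈acc) = disj a∈acc (there (∈-++⁺ˡ a∈))
    chain-ys : Chain u ys
    chain-ys with chain-++⁻ u pre c
    ... | c-pre , a , _ = chain-++⁺ u pre c-pre (a , proj₁ (chain-++⁻ q acc c-acc))

  -- A walk that left u ∷ P at u and has reached q: acc lists the vertices strictly between,
  -- latest first, and Q continues the walk to r.  As r lies on P, the walk comes back to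
  -- u ∷ P, which closes a cycle.
  no-rejoin : ∀ {u q r} (P : Path u r) (Q : Path q r) (acc : List (Fin n)) →
              Chain q (acc ++ [ u ]) → 1 ≤ length acc → (q ≡ u → 2 ≤ length acc) →
              Distinct acc → (∀ {a} → a ∈ acc → a ∉ q ∷ vertices Q) →
              (∀ {a} → a ∈ acc → a ∉ u ∷ vertices P) → ⊥
  no-rejoin {u} {q} P Q acc c l₁ l₂ d disjQ disjP with q ∈? u ∷ vertices P
  ... | yes (here refl) with chain-++⁻ u acc c
  ...   | c-acc , closing , _ =
    no-closed-chain u acc ((λ u∈ → disjQ u∈ (here refl)) , d) (l₂ refl) c-acc closing
  no-rejoin P Q acc c l₁ l₂ d disjQ disjP | yes (there q∈) =
    no-detour P acc q∈ c l₁ d (λ q∈ → disjQ q∈ (here refl)) disjP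
  no-rejoin {u} P (path [] _ refl _) acc c l₁ l₂ d disjQ disjP | no q∉ =
    q∉ (subst (_∈ u ∷ vertices P) (ends P) (end∈ u (vertices P)))
  no-rejoin {u} {q} P (path (q′ ∷ qs) (a , c′) e (q∉qs , d′)) acc c l₁ l₂ d disjQ disjP | no q∉ =
    no-rejoin P (path qs c′ e d′) (q ∷ acc) (sym G a , c) (s≤s z≤n) (λ _ → s≤s l₁)
      ((λ q∈ → disjQ q∈ (here refl)) , d)
      (λ { (here refl) → q∉qs ; (there a∈) q∈ → disjQ a∈ (there q∈) })
      (λ { (here refl) → q∉ ; (there a∈) → disjP a∈ })

  edge-along-paths : ∀ {u v r} (P : Path u r) (Q : Path v r) → Adj G u v →
                     head (vertices P) ≡ just v ⊎ head (vertices Q) ≡ just u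
  edge-along-paths {u} {v} P Q a with v ∈? u ∷ vertices P
  ... | yes v∈ = inj₁ (neighbour-on-path⇒next P a v∈)
  ... | no v∉ with u ∈? v ∷ vertices Q
  ...   | yes u∈ = inj₂ (neighbour-on-path⇒next Q (sym G a) u∈)
  ...   | no u∉ = ⊥-elim (leave Q u∉)
    where
    leave : (Q : Path v _) → u ∉ v ∷ vertices Q → ⊥
    leave (path [] _ refl _) _ = v∉ (subst (_∈ u ∷ vertices P) (ends P) (end∈ u (vertices P)))
    leave (path (q ∷ qs) (a′ , c) e (v∉qs , d)) u∉ =
      no-rejoin P (path qs c e d) [ v ] (sym G a′ , sym G a , tt) (s≤s z≤n)
        (λ { refl → ⊥-elim (u∉ (there (here refl))) })
        ((λ ()) , tt)
        (λ { (here refl) → v∉qs })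
        (λ { (here refl) → v∉ })

  path-length-unique : ∀ {u r} (P Q : Path u r) → length (vertices P) ≡ length (vertices Q)
  path-length-unique (path ps cp ep dp) (path qs cq eq dq) = lengths ps qs cp ep dp cq eq dq
    where
    head∈ : ∀ xs {x} → head xs ≡ just x → x ∈ xs
    head∈ (x ∷ xs) refl = here refl
    lengths : ∀ {u r} ps qs → Chain u ps → end u ps ≡ r → Distinct (u ∷ ps) →
              Chain u qs → end u qs ≡ r → Distinct (u ∷ qs) → length ps ≡ length qs
    lengths []       []       _ _ _ _ _ _ = refl
    lengths []       (q ∷ qs) _ refl _ _ e (u∉ , _) = ⊥-elim (u∉ (subst (_∈ q ∷ qs) e (end∈ q qs)))
    lengths (p ∷ ps) []       _ e (u∉ , _) _ refl _ = ⊥-elim (u∉ (subst (_∈ p ∷ ps) e (end∈ p ps)))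
    lengths (p ∷ ps) (q ∷ qs) (a , cp) ep (u∉ps , dp) (b , cq) eq (u∉qs , dq)
      with edge-along-paths (path (q ∷ qs) (b , cq) eq (u∉qs , dq)) (path ps cp ep dp) a
    ... | inj₁ refl = cong suc (lengths ps qs cp ep dp cq eq dq)
    ... | inj₂ hd = ⊥-elim (u∉ps (there (head∈ ps hd)))

  trivial-path : ∀ {r} (P : Path r r) → vertices P ≡ []
  trivial-path (path []       _ _ _)       = refl
  trivial-path (path (q ∷ qs) _ e (r∉ , _)) = ⊥-elim (r∉ (subst (_∈ q ∷ qs) e (end∈ q qs)))

module RootedTree {n : ℕ} (T : Graph n) (acyclic : ¬ HasCycle T) (connected : Connected T)
                  (r f : Fin n) where
  open ListWalks T
  open AcyclicPaths T acyclic

  path-to-root : ∀ x → Path x r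
  path-to-root x = walk⇒path (proj₂ (connected x r))

  depth : Fin n → ℕ
  depth x = length (vertices (path-to-root x))

  -- The root has no parent; it is sent to f instead.
  parent : Fin n → Fin n
  parent x = fromMaybe f (head (vertices (path-to-root x)))

  depth-root : depth r ≡ 0
  depth-root = cong length (trivial-path (path-to-root r))

  parent-root : parent r ≡ f
  parent-root = cong (λ vs → fromMaybe f (head vs)) (trivial-path (path-to-root r))

  depth-zero : ∀ x → depth x ≡ 0 → x ≡ r
  depth-zero x = length-zero (path-to-root x)
    where
    length-zero : (P : Path x r) → length (vertices P) ≡ 0 → x ≡ r
    length-zero (path [] _ e _) _ = e

  parent-adjacent : ∀ x → x ≢ r → Adj T x (parent x)
  parent-adjacent x = first-step (path-to-root x)
    where
    first-step : (P : Path x r) → x ≢ r → Adj T x (fromMaybe f (head (vertices P)))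
    first-step (path []      _       e _) x≢r = ⊥-elim (x≢r e)
    first-step (path (_ ∷ _) (a , _) _ _) _   = a

  depth-parent : ∀ x → x ≢ r → suc (depth (parent x)) ≡ depth x
  depth-parent x = tail-length (path-to-root x)
    where
    tail-length : (P : Path x r) → x ≢ r →
                  suc (depth (fromMaybe f (head (vertices P)))) ≡ length (vertices P)
    tail-length (path []       _       e _)       x≢r = ⊥-elim (x≢r e)
    tail-length (path (y ∷ ys) (_ , c) e (_ , d)) _   =
      cong suc (path-length-unique (path-to-root y) (path ys c e d))

  next-on-path-to-root : ∀ {x y} (P : Path x r) → head (vertices P) ≡ just y →
                         x ≢ r × fromMaybe f (head (vertices P)) ≡ y
  next-on-path-to-root (path (z ∷ zs) _ e (x∉ , _)) refl =
    (λ { refl → x∉ (subst (_∈ z ∷ zs) e (end∈ z zs)) }) , refl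

  edge⇒parent : ∀ x y → Adj T x y → (x ≢ r × parent x ≡ y) ⊎ (y ≢ r × parent y ≡ x)
  edge⇒parent x y a with edge-along-paths (path-to-root x) (path-to-root y) a
  ... | inj₁ h = inj₁ (next-on-path-to-root (path-to-root x) h)
  ... | inj₂ h = inj₂ (next-on-path-to-root (path-to-root y) h)

  walk-to-root : ∀ x → Walk T x r (depth x)
  walk-to-root x with path-to-root x
  ... | path vs c refl _ = chain⇒walk x vs c

module Iteration {A : Set} (g : A → A) where
  open import Function.Endo.Propositional A using (_^_; ^-homo) public

  NoCycleShorterThan : ℕ → Set
  NoCycleShorterThan L = ∀ z k → 0 < k → k < L → (g ^ k) z ≢ z

  ^-+ : ∀ m k z → (g ^ (m + k)) z ≡ (g ^ m) ((g ^ k) z)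
  ^-+ m k = cong-app (^-homo g m k)

  ^-suc′ : ∀ k z → (g ^ suc k) z ≡ (g ^ k) (g z)
  ^-suc′ k z = trans (cong (λ i → (g ^ i) z) (+-comm 1 k)) (^-+ k 1 z)

  no-cycle-shorter-than-≤ : ∀ {L L′} → L′ ≤ L → NoCycleShorterThan L → NoCycleShorterThan L′
  no-cycle-shorter-than-≤ L′≤L long z k 0<k k<L′ = long z k 0<k (≤-trans k<L′ L′≤L)

  module _ {L : ℕ} (long : NoCycleShorterThan L) where

    ^-collision : ∀ z {s t} → s < t → (g ^ s) z ≡ (g ^ t) z → s + L ≤ t
    ^-collision z {s} {t} s<t e with L ≤? t ∸ s
    ... | yes L≤t∸s = subst (s + L ≤_) (m+[n∸m]≡n (<⇒≤ s<t)) (+-monoʳ-≤ s L≤t∸s)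
    ... | no L≰t∸s  = ⊥-elim (long ((g ^ s) z) (t ∸ s) (m<n⇒0<n∸m s<t) (≰⇒> L≰t∸s) returns)
      where
      returns : (g ^ (t ∸ s)) ((g ^ s) z) ≡ (g ^ s) z
      returns = trans (≡.sym (^-+ (t ∸ s) s z))
                      (trans (cong (λ i → (g ^ i) z) (m∸n+n≡m (<⇒≤ s<t))) (≡.sym e))

    ^-injective : ∀ z {s t} → s < L → t < L → (g ^ s) z ≡ (g ^ t) z → s ≡ t
    ^-injective z {s} {t} s<L t<L e with <-cmp s t
    ... | tri< s<t _ _ = ⊥-elim (<⇒≱ t<L (m+n≤o⇒n≤o s (^-collision z s<t e)))
    ... | tri≈ _ s≡t _ = s≡t
    ... | tri> _ _ t<s = ⊥-elim (<⇒≱ s<L (m+n≤o⇒n≤o t (^-collision z t<s (≡.sym e))))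

  module _ (r : A) (depth : A → ℕ) (depth-root : depth r ≡ 0)
           (depth-zero : ∀ z → depth z ≡ 0 → z ≡ r)
           (depth-parent : ∀ z → z ≢ r → suc (depth (g z)) ≡ depth z) where

    depth-^ : ∀ k z → k ≤ depth z → depth ((g ^ k) z) + k ≡ depth z
    depth-^ zero    z _ = +-identityʳ (depth z)
    depth-^ (suc k) z k<d = begin
      depth (g ((g ^ k) z)) + suc k  ≡⟨ +-suc _ k ⟩
      suc (depth (g ((g ^ k) z))) + k ≡⟨ cong (_+ k) (depth-parent _ not-root) ⟩
      depth ((g ^ k) z) + k          ≡⟨ IH ⟩
      depth z                        ∎
      where
      open ≡.≡-Reasoning
      IH = depth-^ k z (<⇒≤ k<d)
      not-root : (g ^ k) z ≢ r
      not-root e = <-irrefl (trans (cong (_+ k) (≡.sym depth-root))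
                                   (trans (cong (λ v → depth v + k) (≡.sym e)) IH)) k<d

    ^-depth : ∀ z → (g ^ depth z) z ≡ r
    ^-depth z = depth-zero _ (+-cancelʳ-≡ (depth z) _ 0 (depth-^ (depth z) z ≤-refl))

    ^-past-root : ∀ z {k} → depth z < k → (g ^ k) z ≡ (g ^ (k ∸ suc (depth z))) (g r)
    ^-past-root z {k} d<k = begin
      (g ^ k) z                 ≡⟨ cong (λ i → (g ^ i) z) (≡.sym (m∸n+n≡m d<k)) ⟩
      (g ^ (k′ + suc d)) z      ≡⟨ ^-+ k′ (suc d) z ⟩
      (g ^ k′) (g ((g ^ d) z))  ≡⟨ cong (λ v → (g ^ k′) (g v)) (^-depth z) ⟩
      (g ^ k′) (g r)            ∎
      where
      open ≡.≡-Reasoning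
      d = depth z
      k′ = k ∸ suc d

    ^-≢-within-depth : ∀ z {k} → 0 < k → k ≤ depth z → (g ^ k) z ≢ z
    ^-≢-within-depth z {k} 0<k k≤d e = <⇒≢ 0<k (≡.sym (+-cancelˡ-≡ (depth z) k 0 (begin
      depth z + k            ≡⟨ cong (λ v → depth v + k) (≡.sym e) ⟩
      depth ((g ^ k) z) + k  ≡⟨ depth-^ k z k≤d ⟩
      depth z                ≡⟨ ≡.sym (+-identityʳ _) ⟩
      depth z + 0            ∎)))
      where open ≡.≡-Reasoning

    ^-≢-past-root : ∀ z {k} → depth z < k → k ≤ depth (g r) → (g ^ k) z ≢ z
    ^-≢-past-root z {k} d<k k≤dgr e = n≮n (d + k′) (begin-strict
      d + k′        <⟨ n<1+n (d + k′) ⟩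
      suc (d + k′)  ≡⟨ cong suc (+-comm d k′) ⟩
      suc (k′ + d)  ≡⟨ ≡.sym (+-suc k′ d) ⟩
      k′ + suc d    ≡⟨ m∸n+n≡m d<k ⟩
      k             ≤⟨ k≤dgr ⟩
      depth (g r)   ≡⟨ ≡.sym returns-after-k′ ⟩
      d + k′        ∎)
      where
      open ≤-Reasoning
      d = depth z
      k′ = k ∸ suc d
      returns-after-k′ : d + k′ ≡ depth (g r)
      returns-after-k′ = trans (cong (λ v → depth v + k′) (trans (≡.sym e) (^-past-root z d<k)))
                               (depth-^ k′ (g r) (≤-trans (m∸n≤m k (suc d)) k≤dgr))

    no-cycle-shorter-than-root-orbit : NoCycleShorterThan (suc (depth (g r)))
    no-cycle-shorter-than-root-orbit z k 0<k (s≤s k≤dgr) with k ≤? depth z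
    ... | yes k≤d = ^-≢-within-depth z 0<k k≤d
    ... | no k≰d  = ^-≢-past-root z (≰⇒> k≰d) k≤dgr

m∸n<m : ∀ {m n} → 0 < n → n ≤ m → m ∸ n < m
m∸n<m {suc m} {suc n} _ _ = s≤s (m∸n≤m m n)

injective-into-image⇒≤ : ∀ {A : Set} {m q} (a : Fin m → A) → Injective _≡_ _≡_ a →
                         (c : ℕ → A) → (∀ i → ∃[ k ] k < q × c k ≡ a i) → m ≤ q
injective-into-image⇒≤ a a-inj c covered = injective⇒≤ {f = label} label-inj
  where
  label = λ i → fromℕ< (proj₁ (proj₂ (covered i)))
  label-inj : Injective _≡_ _≡_ label
  label-inj {i} {j} e with covered i | covered j
  ... | k , k<q , cₖ≡aᵢ | k′ , k′<q , cₖ′≡aⱼ with fromℕ<-injective k k′ k<q k′<q e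
  ... | refl = a-inj (trans (≡.sym cₖ≡aᵢ) cₖ′≡aⱼ)

module ParentMapCompetition {n : ℕ} (T : Graph n) (r : Fin n) (g : Fin n → Fin n) (q : ℕ)
    (parent-adjacent : ∀ x → x ≢ r → Adj T x (g x))
    (edge⇒parent : ∀ x y → Adj T x y → (x ≢ r × g x ≡ y) ⊎ (y ≢ r × g y ≡ x))
    (long-cycles : Iteration.NoCycleShorterThan g (3 + suc q)) where
  open Iteration g

  p : ℕ
  p = suc q

  Preys : Fin n → Fin n → Set
  Preys x a = (∃[ k ] k < p × (g ^ k) x ≡ a) ⊎ (a ≢ r × g a ≡ x)

  D : Digraph n
  D = record { Arc = Preys }

  CommonPrey : Fin n → Fin n → Set
  CommonPrey x y =
    Σ (Fin p → Fin n) λ a → Injective _≡_ _≡_ a × (∀ i → Preys x (a i) × Preys y (a i))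

  common-prey-sym : ∀ {x y} → CommonPrey x y → CommonPrey y x
  common-prey-sym (a , a-inj , both) = a , a-inj , λ i → proj₂ (both i) , proj₁ (both i)

  ≤p⇒<3+p : ∀ {l} → l ≤ p → l < 3 + p
  ≤p⇒<3+p l≤p = s≤s (m≤n⇒m≤o+n 2 l≤p)

  iterates-injective : ∀ z → Injective _≡_ _≡_ (λ (i : Fin p) → (g ^ toℕ i) z)
  iterates-injective z e =
    toℕ-injective (^-injective long-cycles z (≤p⇒<3+p (<⇒≤ (toℕ<n _))) (≤p⇒<3+p (<⇒≤ (toℕ<n _))) e)

  parent⇒common-prey : ∀ x → x ≢ r → CommonPrey x (g x)
  parent⇒common-prey x x≢r = (λ i → (g ^ toℕ i) x) , iterates-injective x , both-prey
    where
    both-prey : ∀ i → Preys x ((g ^ toℕ i) x) × Preys (g x) ((g ^ toℕ i) x)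
    both-prey Fin.zero    = inj₁ (0 , s≤s z≤n , refl) , inj₂ (x≢r , refl)
    both-prey (Fin.suc i) = inj₁ (suc (toℕ i) , toℕ<n (Fin.suc i) , refl) ,
                            inj₁ (toℕ i , m<n⇒m<1+n (toℕ<n i) , ≡.sym (^-suc′ (toℕ i) x))

  few-common-prey : ∀ {x y} (c : ℕ → Fin n) →
                    (∀ a → Preys x a → Preys y a → ∃[ k ] k < q × c k ≡ a) → ¬ CommonPrey x y
  few-common-prey c covered (a , a-inj , both) =
    n≮n q (injective-into-image⇒≤ a a-inj c λ i → covered (a i) (proj₁ (both i)) (proj₂ (both i)))

  NearAncestor : Fin n → Fin n → Set
  NearAncestor x y = ∃[ l ] l < p × (g ^ suc l) y ≡ x

  unrelated⇒few-common-prey : ∀ {x y} → x ≢ y → ¬ NearAncestor x y → ¬ NearAncestor y x →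
                              ¬ CommonPrey x y
  unrelated⇒few-common-prey {x} {y} x≢y x↛y y↛x = few-common-prey (λ k → (g ^ suc k) x) covered
    where
    covered : ∀ a → Preys x a → Preys y a → ∃[ k ] k < q × (g ^ suc k) x ≡ a
    covered a (inj₁ (suc k , k<p , e)) _                        = k , ≤-pred k<p , e
    covered a (inj₁ (zero , _ , refl)) (inj₁ (zero , _ , y≡x))  = ⊥-elim (x≢y (≡.sym y≡x))
    covered a (inj₁ (zero , _ , refl)) (inj₁ (suc l , l<p , e)) = ⊥-elim (x↛y (l , <-trans (n<1+n l) l<p , e))
    covered a (inj₁ (zero , _ , refl)) (inj₂ (_ , gx≡y))        = ⊥-elim (y↛x (0 , s≤s z≤n , gx≡y))
    covered a (inj₂ (_ , ga≡x))        (inj₁ (l , l<p , refl))  = ⊥-elim (x↛y (l , l<p , ga≡x))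
    covered a (inj₂ (_ , ga≡x))        (inj₂ (_ , ga≡y))        = ⊥-elim (x≢y (trans (≡.sym ga≡x) ga≡y))

  near-ancestor⇒few-common-prey : ∀ {x y} → x ≢ y → ¬ (y ≢ r × g y ≡ x) → NearAncestor x y →
                                  ¬ CommonPrey x y
  near-ancestor⇒few-common-prey {x} {y} x≢y not-child (j , j<p , x-above-y) =
    few-common-prey candidate covered
    where
    open ≤-Reasoning

    j≤q : j ≤ q
    j≤q = ≤-pred j<p

    -- Exponents k of x with k + j ∈ {q, q + 1} give no common prey (far-exponent); the
    -- child g^j y of x takes the first of these two places.
    candidate : ℕ → Fin n
    candidate k with <-cmp (k + j) q
    ... | tri< _ _ _ = (g ^ k) x
    ... | tri≈ _ _ _ = (g ^ j) y
    ... | tri> _ _ _ = (g ^ suc k) x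

    candidate-< : ∀ {k} → k + j < q → candidate k ≡ (g ^ k) x
    candidate-< {k} h with <-cmp (k + j) q
    ... | tri< _ _ _ = refl
    ... | tri≈ ¬h _ _ = ⊥-elim (¬h h)
    ... | tri> ¬h _ _ = ⊥-elim (¬h h)

    candidate-≈ : ∀ {k} → k + j ≡ q → candidate k ≡ (g ^ j) y
    candidate-≈ {k} h with <-cmp (k + j) q
    ... | tri< _ ¬h _ = ⊥-elim (¬h h)
    ... | tri≈ _ _ _ = refl
    ... | tri> _ ¬h _ = ⊥-elim (¬h h)

    candidate-> : ∀ {k} → q < k + j → candidate k ≡ (g ^ suc k) x
    candidate-> {k} h with <-cmp (k + j) q
    ... | tri< _ _ ¬h = ⊥-elim (¬h h)
    ... | tri≈ _ _ ¬h = ⊥-elim (¬h h)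
    ... | tri> _ _ _ = refl

    x-from-y : ∀ k → (g ^ k) x ≡ (g ^ (k + suc j)) y
    x-from-y k = trans (cong (g ^ k) (≡.sym x-above-y)) (≡.sym (^-+ k (suc j) y))

    far-exponent : ∀ k → q ≤ k + j → Preys y ((g ^ k) x) → suc q < k + j
    far-exponent k q≤k+j (inj₁ (l , l<p , e)) = ≤-pred (begin
      suc (suc (suc q))  ≤⟨ n≤1+n _ ⟩
      3 + p              ≤⟨ m≤n+m (3 + p) l ⟩
      l + (3 + p)        ≤⟨ ^-collision long-cycles y l<k+1+j (trans e (x-from-y k)) ⟩
      k + suc j          ≡⟨ +-suc k j ⟩
      suc (k + j)        ∎)
      where
      l<k+1+j : l < k + suc j
      l<k+1+j = ≤-trans l<p (≤-trans (s≤s q≤k+j) (≤-reflexive (≡.sym (+-suc k j))))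
    far-exponent k q≤k+j (inj₂ (_ , e)) = ≤-pred (≤-pred (begin
      3 + p              ≤⟨ ^-collision long-cycles y (s≤s z≤n) (trans (≡.sym e) (x-from-y (suc k))) ⟩
      suc k + suc j      ≡⟨ cong suc (+-suc k j) ⟩
      suc (suc (k + j))  ∎))

    above : ∀ k → k < p → suc q < k + j → ∃[ k′ ] k′ < q × candidate k′ ≡ (g ^ k) x
    above zero    _   h = ⊥-elim (<⇒≱ h (≤-trans j≤q (n≤1+n q)))
    above (suc k) k<p h = k , ≤-pred k<p , candidate-> (≤-pred h)

    covered : ∀ a → Preys x a → Preys y a → ∃[ k ] k < q × candidate k ≡ a
    covered a (inj₁ (k , k<p , refl)) ay with k + j <? q
    ... | yes k+j<q = k , ≤-<-trans (m≤m+n k j) k+j<q , candidate-< k+j<q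
    ... | no k+j≮q  = above k k<p (far-exponent k (≮⇒≥ k+j≮q) ay)
    covered a (inj₂ (a≢r , ga≡x)) (inj₁ (zero , _ , refl)) = ⊥-elim (not-child (a≢r , ga≡x))
    covered a (inj₂ (_ , ga≡x)) (inj₁ (suc l , l<p , refl)) =
      q ∸ j , m∸n<m (subst (0 <_) 1+l≡j (s≤s z≤n)) j≤q ,
      trans (candidate-≈ (m∸n+n≡m j≤q)) (cong (λ i → (g ^ i) y) (≡.sym 1+l≡j))
      where
      1+l≡j : suc l ≡ j
      1+l≡j = suc-injective (^-injective long-cycles y (≤p⇒<3+p l<p) (≤p⇒<3+p j<p)
                                                (trans ga≡x (≡.sym x-above-y)))
    covered a (inj₂ (_ , ga≡x)) (inj₂ (_ , ga≡y)) = ⊥-elim (x≢y (trans (≡.sym ga≡x) ga≡y))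

  near-ancestor? : ∀ x y → Dec (NearAncestor x y)
  near-ancestor? x y = anyUpTo? (λ l → (g ^ suc l) y Fin.≟ x) p

  child? : ∀ x y → Dec (x ≢ r × g x ≡ y)
  child? x y with x Fin.≟ r | g x Fin.≟ y
  ... | yes x≡r | _        = no λ (x≢r , _) → x≢r x≡r
  ... | no x≢r  | yes gx≡y = yes (x≢r , gx≡y)
  ... | no _    | no gx≢y  = no λ (_ , gx≡y) → gx≢y gx≡y

  non-adjacent⇒few-common-prey : ∀ {x y} → x ≢ y → ¬ (x ≢ r × g x ≡ y) →
                                 ¬ (y ≢ r × g y ≡ x) → ¬ CommonPrey x y
  non-adjacent⇒few-common-prey {x} {y} x≢y x-not-child y-not-child
    with near-ancestor? x y | near-ancestor? y x
  ... | yes x-near | _          = near-ancestor⇒few-common-prey x≢y y-not-child x-near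
  ... | no _       | yes y-near =
    λ common → near-ancestor⇒few-common-prey (≢-sym x≢y) x-not-child y-near (common-prey-sym common)
  ... | no x↛y     | no y↛x     = unrelated⇒few-common-prey x≢y x↛y y↛x

  competition : IsCompetitionOf p D T
  competition x y x≢y = mk⇔ adjacent⇒common-prey common-prey⇒adjacent
    where
    adjacent⇒common-prey : Adj T x y → CommonPrey x y
    adjacent⇒common-prey a with edge⇒parent x y a
    ... | inj₁ (x≢r , refl) = parent⇒common-prey x x≢r
    ... | inj₂ (y≢r , refl) = common-prey-sym (parent⇒common-prey y y≢r)
    common-prey⇒adjacent : CommonPrey x y → Adj T x y
    common-prey⇒adjacent common with child? x y | child? y x
    ... | yes (x≢r , refl) | _                  = parent-adjacent x x≢r
    ... | no _             | yes (y≢r , refl)   = sym T (parent-adjacent y y≢r)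
    ... | no x-not-child   | no y-not-child     =
      ⊥-elim (non-adjacent⇒few-common-prey x≢y x-not-child y-not-child common)

  p≤n : p ≤ n
  p≤n = injective⇒≤ (iterates-injective r)

  p∈Υ : InΥ T p
  p∈Υ = s≤s z≤n , p≤n , D , competition

mainTheorem12 : ∀ (n : ℕ) (T : Graph n) (m : ℕ) → IsTree T → Diameter T m → 3 ≤ m →
    ∀ (p : ℕ) → 1 ≤ p → p ≤ m ∸ 2 → InΥ T p
mainTheorem12 n T m (connected , acyclic) (_ , x₀ , y₀ , _ , shortest) 3≤m (suc q) _ p≤m∸2 = p∈Υ
  where
  open RootedTree T acyclic connected y₀ x₀
  open Iteration parent

  2+p≤depth : 2 + suc q ≤ depth (parent y₀)
  2+p≤depth = begin
    2 + suc q        ≤⟨ +-monoʳ-≤ 2 p≤m∸2 ⟩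
    2 + (m ∸ 2)      ≡⟨ m+[n∸m]≡n (≤-trans (n≤1+n 2) 3≤m) ⟩
    m                ≤⟨ shortest (depth x₀) (walk-to-root x₀) ⟩
    depth x₀         ≡⟨ cong depth (≡.sym parent-root) ⟩
    depth (parent y₀) ∎
    where open ≤-Reasoning

  long-cycles : NoCycleShorterThan (3 + suc q)
  long-cycles = no-cycle-shorter-than-≤ (s≤s 2+p≤depth)
    (no-cycle-shorter-than-root-orbit y₀ depth depth-root depth-zero depth-parent)

  open ParentMapCompetition T y₀ parent q parent-adjacent edge⇒parent long-cycles
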